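{- Let $0\le l<n$. The number of elements of rank $r$ of $P_{n,l}$ is $$W_r=\binom{n}{r}\sum_{i=0}^l\binom{r-1}{i}\quad\text{for }1\le r\le n,$$ and the sequence $(W_1,\dots,W_n)$ is log-concave, i.e. $W_{i-1}W_{i+1}\le W_i^2$ for $2\le i\le n-1$; that is, $P_{n,l}$ is rank-log-concave.
   Context: A projective sign vector of length $n$ is an element of $\{0,+,-\}^n\setminus\{(0,\dots,0)\}$ modulo the identification $(v_1,\dots,v_n)\sim(-v_1,\dots,-v_n)$. Its number of sign changes is the number of sign changes in the sequence of its nonzero entries (read left to right). For $0\le l<n$, $P_{n,l}$ is the poset of projective sign vectors of length $n$ with at most $l$ sign changes, where $v\le w$ iff for suitable representatives $v_i\in\{0,w_i\}$ for all $1\le i\le n$. It is graded with ranks labeled $1$ to $n$, the rank of $v$ being its number of nonzero entries. -}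

module Defs where

open import Data.Nat using (ℕ; zero; suc; _+_; _*_; _∸_; _≤_)
open import Data.Nat.Combinatorics using (_C_)
open import Data.List using (List; []; _∷_; map; upTo)
open import Data.Nat.ListAction using (sum)
open import Data.Vec using (Vec; []; _∷_)
open import Data.Fin using (Fin)
open import Data.Product using (Σ; _×_; ∃; proj₁)
open import Data.Sum using (_⊎_)
open import Relation.Binary.PropositionalEquality using (_≡_; _≢_)
open import Data.Vec.Relation.Unary.Any using (Any)

data Sign : Set where
  𝟎 ⊕ ⊖ : Sign

neg : Sign → Sign
neg 𝟎 = 𝟎
neg ⊕ = ⊖
neg ⊖ = ⊕

negV : ∀ {n} → Vec Sign n → Vec Sign n
negV [] = []
negV (x ∷ v) = neg x ∷ negV v

nonzeros : ∀ {n} → Vec Sign n → List Sign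
nonzeros [] = []
nonzeros (𝟎 ∷ v) = nonzeros v
nonzeros (⊕ ∷ v) = ⊕ ∷ nonzeros v
nonzeros (⊖ ∷ v) = ⊖ ∷ nonzeros v

differ : Sign → Sign → ℕ
differ ⊕ ⊖ = 1
differ ⊖ ⊕ = 1
differ _ _ = 0

changesL : List Sign → ℕ
changesL [] = 0
changesL (a ∷ []) = 0
changesL (a ∷ b ∷ xs) = differ a b + changesL (b ∷ xs)

signChanges : ∀ {n} → Vec Sign n → ℕ
signChanges v = changesL (nonzeros v)

rank : ∀ {n} → Vec Sign n → ℕ
rank [] = 0
rank (𝟎 ∷ v) = rank v
rank (⊕ ∷ v) = suc (rank v)
rank (⊖ ∷ v) = suc (rank v)

-- representatives of elements of P_{n,l} of rank r:
-- nonzero sign vectors of length n with at most l sign changes and r nonzero entries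
RankElem : (n l r : ℕ) → Set
RankElem n l r =
  Σ (Vec Sign n) λ v → Any (λ x → x ≢ 𝟎) v × signChanges v ≤ l × rank v ≡ r

_≈P_ : ∀ {n l r} → RankElem n l r → RankElem n l r → Set
a ≈P b = proj₁ a ≡ proj₁ b ⊎ proj₁ a ≡ negV (proj₁ b)

-- A has exactly k elements modulo the equivalence _~_
-- (a bijection from Fin k onto the quotient A/~)
HasCardMod : (A : Set) → (A → A → Set) → ℕ → Set
HasCardMod A _~_ k =
  Σ (Fin k → A) λ f →
    (∀ i j → f i ~ f j → i ≡ j) × (∀ a → ∃ λ i → f i ~ a)

W : (n l r : ℕ) → ℕ
W n l r = (n C r) * sum (map (λ i → (r ∸ 1) C i) (upTo (suc l)))

{-# OPTIONS --safe #-}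
module Submission where

-- A projective sign vector of rank r has exactly one representative whose first nonzero
-- entry is +.  Such a representative is a choice of the r nonzero positions (C(n,r) ways)
-- followed by a sign pattern with at most l changes in the r - 1 gaps between consecutive
-- nonzero entries (Σ_{i≤l} C(r-1,i) ways); the enumeration is built by recursion on the
-- first entry of the vector.
--
-- For log-concavity write W_{r+1} = C(n,r+1) S(r) with S(m) = Σ_{i≤l} C(m,i).  Both
-- factors are log-concave, and a product of log-concave sequences is log-concave.  For S
-- one uses S(m+1) = 2 S(m) - C(m,l), which reduces S(m) S(m+2) ≤ S(m+1)² to
-- S(m) C(m,l) ≤ C(m,l)² + S(m) C(m,l-1); the latter follows by induction on l from the
-- log-concavity of the binomial coefficients.

open import Defs
open import Data.Nat
open import Data.Nat.Properties
open import Data.Nat.Combinatorics using (_C_; nCk+nC[k+1]≡[n+1]C[k+1])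
open import Data.Nat.Tactic.RingSolver using (solve-∀)
open import Data.Nat.ListAction using (sum)
open import Data.Nat.ListAction.Properties using (sum-++)
open import Data.List using ([]; _∷_; map; upTo; _++_)
open import Data.List.Properties using (upTo-∷ʳ; map-++)
open import Data.Bool using (Bool; true; false; not)
open import Data.Fin using (Fin; zero; suc; splitAt; _↑ˡ_; _↑ʳ_)
open import Data.Fin.Properties using (splitAt-↑ˡ; splitAt-↑ʳ; splitAt⁻¹-↑ˡ; splitAt⁻¹-↑ʳ)
open import Data.Vec using (Vec; []; _∷_)
open import Data.Vec.Properties using (∷-injectiveʳ)
open import Data.Vec.Relation.Unary.Any using (Any; here; there)
open import Data.Product using (Σ; _×_; _,_; ∃)
open import Data.Sum using (_⊎_; inj₁; inj₂; [_,_])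
open import Data.Empty using (⊥; ⊥-elim)
open import Relation.Binary.PropositionalEquality
  using (_≡_; _≢_; refl; sym; trans; cong; cong₂; subst; module ≡-Reasoning)

-- Pascal's rule as the definition (_C_ is defined through factorials), so that induction computes.
binom : ℕ → ℕ → ℕ
binom zero    zero    = 1
binom zero    (suc k) = 0
binom (suc n) zero    = 1
binom (suc n) (suc k) = binom n k + binom n (suc k)

binom≡C : ∀ n k → binom n k ≡ n C k
binom≡C zero    zero    = refl
binom≡C zero    (suc k) = refl
binom≡C (suc n) zero    = refl
binom≡C (suc n) (suc k) =
  trans (cong₂ _+_ (binom≡C n k) (binom≡C n (suc k))) (nCk+nC[k+1]≡[n+1]C[k+1] n k)

binom-zero : ∀ n → binom n 0 ≡ 1
binom-zero zero    = refl
binom-zero (suc n) = refl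

binom-one : ∀ n → binom n 1 ≡ n
binom-one zero    = refl
binom-one (suc n) = cong₂ _+_ (binom-zero n) (binom-one n)

-- (k+1) C(n,k+1) = (n-k) C(n,k), with the subtracted term moved to the left.
binom-absorb : ∀ n k → binom n (suc k) * suc k + k * binom n k ≡ n * binom n k
binom-absorb zero    zero    = refl
binom-absorb zero    (suc k) = *-zeroʳ (suc k)
binom-absorb (suc n) zero    rewrite binom-zero n | binom-one n =
  trans (+-identityʳ _) (trans (*-identityʳ (suc n)) (sym (*-identityʳ (suc n))))
binom-absorb (suc n) (suc k) = begin
    (b₁ + b₂) * (2 + k) + (1 + k) * (b₀ + b₁)
      ≡⟨ regroup b₀ b₁ b₂ k ⟩
    (b₂ * (2 + k) + (1 + k) * b₁) + (b₁ * (1 + k) + k * b₀) + (b₁ + b₀)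
      ≡⟨ cong₂ (λ x y → x + y + (b₁ + b₀)) (binom-absorb n (suc k)) (binom-absorb n k) ⟩
    n * b₁ + n * b₀ + (b₁ + b₀)
      ≡⟨ collect b₀ b₁ n ⟩
    (1 + n) * (b₀ + b₁) ∎
  where
  open ≡-Reasoning
  b₀ = binom n k
  b₁ = binom n (suc k)
  b₂ = binom n (suc (suc k))
  regroup : ∀ b₀ b₁ b₂ k → (b₁ + b₂) * (2 + k) + (1 + k) * (b₀ + b₁)
          ≡ (b₂ * (2 + k) + (1 + k) * b₁) + (b₁ * (1 + k) + k * b₀) + (b₁ + b₀)
  regroup = solve-∀
  collect : ∀ b₀ b₁ n → n * b₁ + n * b₀ + (b₁ + b₀) ≡ (1 + n) * (b₀ + b₁)
  collect = solve-∀

binom-vanishes-upward : ∀ n k → binom n k ≡ 0 → binom n (suc k) ≡ 0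
binom-vanishes-upward n k b≡0 = m*n≡0⇒m≡0 (binom n (suc k)) (suc k)
  (m+n≡0⇒m≡0 _ (trans (binom-absorb n k) (trans (cong (n *_) b≡0) (*-zeroʳ n))))

-- Multiply the absorption identities for k + 1 and for k by C(n,k) and C(n,k+1).
binom-absorb-cross : ∀ n k → let a = binom n k; b = binom n (suc k); c = binom n (suc (suc k)) in
  a * c * (2 + k) + a * b + a * b * k ≡ b * b * (1 + k) + a * b * k
binom-absorb-cross n k = begin
    a * c * (2 + k) + a * b + a * b * k ≡⟨ e₁ a b c k ⟩
    a * (c * (2 + k) + (1 + k) * b)    ≡⟨ cong (a *_) (binom-absorb n (suc k)) ⟩
    a * (n * b)                        ≡⟨ e₂ a b n ⟩
    b * (n * a)                        ≡⟨ cong (b *_) (sym (binom-absorb n k)) ⟩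
    b * (b * (1 + k) + k * a)          ≡⟨ e₃ a b k ⟩
    b * b * (1 + k) + a * b * k        ∎
  where
  open ≡-Reasoning
  a = binom n k
  b = binom n (suc k)
  c = binom n (suc (suc k))
  e₁ : ∀ a b c k → a * c * (2 + k) + a * b + a * b * k ≡ a * (c * (2 + k) + (1 + k) * b)
  e₁ = solve-∀
  e₂ : ∀ a b n → a * (n * b) ≡ b * (n * a)
  e₂ = solve-∀
  e₃ : ∀ a b k → b * (b * (1 + k) + k * a) ≡ b * b * (1 + k) + a * b * k
  e₃ = solve-∀

binom-logConcave : ∀ n k → binom n k * binom n (suc (suc k)) ≤ binom n (suc k) * binom n (suc k)
binom-logConcave n k = *-cancelʳ-≤ (a * c) (b * b) (2 + k) (begin
    a * c * (2 + k)         ≤⟨ m≤m+n _ (a * b) ⟩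
    a * c * (2 + k) + a * b ≡⟨ +-cancelʳ-≡ (a * b * k) _ _ (binom-absorb-cross n k) ⟩
    b * b * (1 + k)         ≤⟨ *-monoʳ-≤ (b * b) (n≤1+n (1 + k)) ⟩
    b * b * (2 + k)         ∎)
  where
  open ≤-Reasoning
  a = binom n k
  b = binom n (suc k)
  c = binom n (suc (suc k))

-- C(m, l-1), with the convention C(m,-1) = 0 (so it is not binom m (l ∸ 1)).
binomPred : ℕ → ℕ → ℕ
binomPred m zero    = 0
binomPred m (suc l) = binom m l

binom-pascal : ∀ m l → binom (suc m) l ≡ binom m l + binomPred m l
binom-pascal m zero    = sym (trans (+-identityʳ _) (binom-zero m))
binom-pascal m (suc l) = +-comm (binom m l) (binom m (suc l))

binomPred-logConcave : ∀ m k → binom m (suc k) * binomPred m k ≤ binom m k * binom m k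
binomPred-logConcave m zero    rewrite *-zeroʳ (binom m 1) = z≤n
binomPred-logConcave m (suc j) =
  ≤-trans (≤-reflexive (*-comm (binom m (suc (suc j))) (binom m j))) (binom-logConcave m j)

partialSum : ℕ → ℕ → ℕ
partialSum m zero    = binom m 0
partialSum m (suc l) = partialSum m l + binom m (suc l)

partialSum≡sum : ∀ m l → sum (map (m C_) (upTo (suc l))) ≡ partialSum m l
partialSum≡sum m zero    = trans (+-identityʳ _) (sym (binom≡C m 0))
partialSum≡sum m (suc l) = begin
    sum (map (m C_) (upTo (suc (suc l))))
      ≡⟨ cong (λ xs → sum (map (m C_) xs)) (sym (upTo-∷ʳ (suc l))) ⟩
    sum (map (m C_) (upTo (suc l) ++ suc l ∷ []))
      ≡⟨ cong sum (map-++ (m C_) (upTo (suc l)) (suc l ∷ [])) ⟩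
    sum (map (m C_) (upTo (suc l)) ++ m C suc l ∷ [])
      ≡⟨ sum-++ (map (m C_) (upTo (suc l))) (m C suc l ∷ []) ⟩
    sum (map (m C_) (upTo (suc l))) + (m C suc l + 0)
      ≡⟨ cong₂ _+_ (partialSum≡sum m l) (trans (+-identityʳ _) (sym (binom≡C m (suc l)))) ⟩
    partialSum m (suc l) ∎
  where open ≡-Reasoning

partialSum-zero : ∀ l → partialSum 0 l ≡ 1
partialSum-zero zero    = refl
partialSum-zero (suc l) = trans (+-identityʳ _) (partialSum-zero l)

partialSum-pascal : ∀ m l → partialSum (suc m) (suc l) ≡ partialSum m (suc l) + partialSum m l
partialSum-pascal m zero    rewrite binom-zero m = +-comm 1 (1 + binom m 1)
partialSum-pascal m (suc l) rewrite partialSum-pascal m l =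
  shuffle (partialSum m (suc l)) (partialSum m l) (binom m (suc l)) (binom m (suc (suc l)))
  where
  shuffle : ∀ a b c d → a + b + (c + d) ≡ a + d + (b + c)
  shuffle = solve-∀

partialSum-double : ∀ m l → partialSum (suc m) l + binom m l ≡ partialSum m l + partialSum m l
partialSum-double m zero    rewrite binom-zero m = refl
partialSum-double m (suc l) rewrite partialSum-pascal m l =
  shuffle (partialSum m l) (binom m (suc l))
  where
  shuffle : ∀ a c → a + c + a + c ≡ a + c + (a + c)
  shuffle = solve-∀

-- The inductive step, with s, a, b, z standing for S(m,k), C(m,k), C(m,k+1), C(m,k-1):
-- multiply by a and cancel it; the case a = 0 is covered by binom-vanishes-upward.
partialSum-step : ∀ s a b z → s * a ≤ a * a + s * z → b * z ≤ a * a → (a ≡ 0 → b ≡ 0)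
                → s * b ≤ s * a + b * a
partialSum-step s zero       b z _  _   a≡0⇒b≡0 rewrite a≡0⇒b≡0 refl | *-zeroʳ s = z≤n
partialSum-step s a@(suc _) b z ih bz≤aa _ = *-cancelˡ-≤ a (begin
    a * (s * b)               ≡⟨ e₁ a s b ⟩
    b * (s * a)               ≤⟨ *-monoʳ-≤ b ih ⟩
    b * (a * a + s * z)       ≡⟨ e₂ a s b z ⟩
    b * a * a + s * (b * z)   ≤⟨ +-monoʳ-≤ (b * a * a) (*-monoʳ-≤ s bz≤aa) ⟩
    b * a * a + s * (a * a)   ≡⟨ e₃ a s b ⟩
    a * (s * a + b * a)       ∎)
  where
  open ≤-Reasoning
  e₁ : ∀ a s b → a * (s * b) ≡ b * (s * a)
  e₁ = solve-∀
  e₂ : ∀ a s b z → b * (a * a + s * z) ≡ b * a * a + s * (b * z)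
  e₂ = solve-∀
  e₃ : ∀ a s b → b * a * a + s * (a * a) ≡ a * (s * a + b * a)
  e₃ = solve-∀

partialSum-binom-bound : ∀ m l → partialSum m l * binom m l ≤ binom m l * binom m l + partialSum m l * binomPred m l
partialSum-binom-bound m zero    rewrite binom-zero m = s≤s z≤n
partialSum-binom-bound m (suc k) = begin
    (s + b) * b         ≡⟨ e₁ s b ⟩
    b * b + s * b       ≤⟨ +-monoʳ-≤ (b * b) (partialSum-step s a b (binomPred m k)
                             (partialSum-binom-bound m k) (binomPred-logConcave m k)
                             (binom-vanishes-upward m k)) ⟩
    b * b + (s * a + b * a) ≡⟨ e₂ s a b ⟩
    b * b + (s + b) * a ∎
  where
  open ≤-Reasoning
  s = partialSum m k
  a = binom m k
  b = binom m (suc k)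
  e₁ : ∀ s b → (s + b) * b ≡ b * b + s * b
  e₁ = solve-∀
  e₂ : ∀ s a b → b * b + (s * a + b * a) ≡ b * b + (s + b) * a
  e₂ = solve-∀

partialSum-logConcave : ∀ m l → partialSum m l * partialSum (2 + m) l ≤ partialSum (1 + m) l * partialSum (1 + m) l
partialSum-logConcave m l = +-cancelʳ-≤ (s * c′) _ _ (begin
    s * s₂ + s * c′     ≡⟨ sym (*-distribˡ-+ s s₂ c′) ⟩
    s * (s₂ + c′)       ≡⟨ cong (s *_) (partialSum-double (suc m) l) ⟩
    s * (s₁ + s₁)       ≡⟨ swap s s₁ ⟩
    s₁ * (s + s)        ≡⟨ cong (s₁ *_) (sym (partialSum-double m l)) ⟩
    s₁ * (s₁ + c)       ≡⟨ *-distribˡ-+ s₁ s₁ c ⟩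
    s₁ * s₁ + s₁ * c    ≤⟨ +-monoʳ-≤ (s₁ * s₁) s₁c≤sc′ ⟩
    s₁ * s₁ + s * c′    ∎)
  where
  open ≤-Reasoning
  s  = partialSum m l
  s₁ = partialSum (suc m) l
  s₂ = partialSum (suc (suc m)) l
  c  = binom m l
  d  = binomPred m l
  c′ = binom (suc m) l
  swap : ∀ s t → s * (t + t) ≡ t * (s + s)
  swap = solve-∀
  regroup : ∀ s c d → s * c + (c * c + s * d) ≡ s * c + s * d + c * c
  regroup = solve-∀
  s₁c≤sc′ : s₁ * c ≤ s * c′
  s₁c≤sc′ = begin
    s₁ * c  ≤⟨ +-cancelʳ-≤ (c * c) _ _ (begin
      s₁ * c + c * c           ≡⟨ sym (*-distribʳ-+ c s₁ c) ⟩
      (s₁ + c) * c             ≡⟨ cong (_* c) (partialSum-double m l) ⟩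
      (s + s) * c              ≡⟨ *-distribʳ-+ c s s ⟩
      s * c + s * c            ≤⟨ +-monoʳ-≤ (s * c) (partialSum-binom-bound m l) ⟩
      s * c + (c * c + s * d)  ≡⟨ regroup s c d ⟩
      s * c + s * d + c * c    ∎) ⟩
    s * c + s * d  ≡⟨ sym (*-distribˡ-+ s c d) ⟩
    s * (c + d)    ≡⟨ cong (s *_) (sym (binom-pascal m l)) ⟩
    s * c′         ∎

*-logConcave : ∀ a b c d x y → a * c ≤ x * x → b * d ≤ y * y → (a * b) * (c * d) ≤ (x * y) * (x * y)
*-logConcave a b c d x y ac≤xx bd≤yy = begin
    (a * b) * (c * d) ≡⟨ interchange a b c d ⟩
    (a * c) * (b * d) ≤⟨ *-mono-≤ ac≤xx bd≤yy ⟩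
    (x * x) * (y * y) ≡⟨ interchange x x y y ⟩
    (x * y) * (x * y) ∎
  where
  open ≤-Reasoning
  interchange : ∀ a b c d → (a * b) * (c * d) ≡ (a * c) * (b * d)
  interchange = solve-∀

W≡binom*partialSum : ∀ n l r → W n l (suc r) ≡ binom n (suc r) * partialSum r l
W≡binom*partialSum n l r = cong₂ _*_ (sym (binom≡C n (suc r))) (partialSum≡sum r l)

W-logConcave : ∀ n l i → 2 ≤ i → W n l (i ∸ 1) * W n l (i + 1) ≤ W n l i * W n l i
W-logConcave n l (suc (suc k)) (s≤s (s≤s z≤n))
  rewrite +-comm k 1 | W≡binom*partialSum n l k | W≡binom*partialSum n l (suc k)
        | W≡binom*partialSum n l (suc (suc k)) =
  *-logConcave (binom n (1 + k)) (partialSum k l) (binom n (3 + k)) (partialSum (2 + k) l)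
               (binom n (2 + k)) (partialSum (1 + k) l)
               (binom-logConcave n (suc k)) (partialSum-logConcave k l)

Enum : {A : Set} → (A → Set) → ℕ → Set
Enum {A} P k = Σ (Fin k → A) λ g →
  (∀ i → P (g i)) × (∀ i j → g i ≡ g j → i ≡ j) × (∀ a → P a → ∃ λ i → g i ≡ a)

enum-⇔ : ∀ {A : Set} {P Q : A → Set} {k} → (∀ a → P a → Q a) → (∀ a → Q a → P a) → Enum P k → Enum Q k
enum-⇔ P⇒Q Q⇒P (g , ok , inj , sur) = g , (λ i → P⇒Q _ (ok i)) , inj , λ a q → sur a (Q⇒P a q)

enum-∅ : ∀ {A : Set} {P : A → Set} → (∀ a → P a → ⊥) → Enum P 0
enum-∅ empty = (λ ()) , (λ ()) , (λ ()) , λ a p → ⊥-elim (empty a p)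

enum-singleton : ∀ {A : Set} {P : A → Set} (a : A) → P a → (∀ b → P b → a ≡ b) → Enum P 1
enum-singleton a pa unique = (λ _ → a) , (λ _ → pa) , (λ { zero zero _ → refl }) , λ b pb → zero , unique b pb

enum-⊎ : ∀ {A : Set} {P Q : A → Set} {a b} → Enum P a → Enum Q b → (∀ x → P x → Q x → ⊥)
       → Enum (λ x → P x ⊎ Q x) (a + b)
enum-⊎ {A} {P} {Q} {a} {b} (g , ok , inj , sur) (h , ok′ , inj′ , sur′) disjoint = G , OK , INJ , SUR
  where
  G : Fin (a + b) → A
  G i = [ g , h ] (splitAt a i)
  OK : ∀ i → P (G i) ⊎ Q (G i)
  OK i with splitAt a i
  ... | inj₁ x = inj₁ (ok x)
  ... | inj₂ y = inj₂ (ok′ y)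
  INJ : ∀ i j → G i ≡ G j → i ≡ j
  INJ i j e with splitAt a i in ei | splitAt a j in ej
  ... | inj₁ x | inj₁ y = trans (sym (splitAt⁻¹-↑ˡ ei)) (trans (cong (_↑ˡ b) (inj x y e)) (splitAt⁻¹-↑ˡ ej))
  ... | inj₂ x | inj₂ y = trans (sym (splitAt⁻¹-↑ʳ ei)) (trans (cong (a ↑ʳ_) (inj′ x y e)) (splitAt⁻¹-↑ʳ ej))
  ... | inj₁ x | inj₂ y = ⊥-elim (disjoint _ (ok x) (subst Q (sym e) (ok′ y)))
  ... | inj₂ x | inj₁ y = ⊥-elim (disjoint _ (ok y) (subst Q e (ok′ x)))
  SUR : ∀ x → P x ⊎ Q x → ∃ λ i → G i ≡ x
  SUR x (inj₁ p) with sur x p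
  ... | i , e = i ↑ˡ b , trans (cong [ g , h ] (splitAt-↑ˡ a i b)) e
  SUR x (inj₂ q) with sur′ x q
  ... | i , e = a ↑ʳ i , trans (cong [ g , h ] (splitAt-↑ʳ a b i)) e

StartsWith : ∀ {n} → Sign → (Vec Sign (suc n) → Set) → Vec Sign (suc n) → Set
StartsWith x P (y ∷ w) = y ≡ x × P (x ∷ w)

enum-∷ : ∀ {n} {P : Vec Sign (suc n) → Set} {k} x → Enum (λ w → P (x ∷ w)) k → Enum (StartsWith x P) k
enum-∷ {P = P} x (g , ok , inj , sur) =
  (λ i → x ∷ g i) , (λ i → refl , ok i) , (λ i j e → inj i j (∷-injectiveʳ e)) , SUR
  where
  SUR : ∀ v → StartsWith x P v → ∃ λ i → x ∷ g i ≡ v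
  SUR (.x ∷ w) (refl , p) with sur w p
  ... | i , e = i , cong (x ∷_) e

startsWith-disjoint : ∀ {n} {x y} {P Q : Vec Sign (suc n) → Set} → x ≢ y
                    → ∀ v → StartsWith x P v → StartsWith y Q v → ⊥
startsWith-disjoint x≢y (_ ∷ _) (refl , _) (refl , _) = x≢y refl

signOf : Bool → Sign
signOf true  = ⊕
signOf false = ⊖

𝟎≢signOf : ∀ s → 𝟎 ≢ signOf s
𝟎≢signOf true  ()
𝟎≢signOf false ()

signOf≢signOf-not : ∀ s → signOf s ≢ signOf (not s)
signOf≢signOf-not true  ()
signOf≢signOf-not false ()

enum-byHead : ∀ {n} {P : Vec Sign (suc n) → Set} {a b c} s
            → Enum (λ w → P (𝟎 ∷ w)) a → Enum (λ w → P (signOf s ∷ w)) b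
            → Enum (λ w → P (signOf (not s) ∷ w)) c → Enum P (a + b + c)
enum-byHead {P = P} s zeros same other =
  enum-⇔ (merge s) (split s)
    (enum-⊎ (enum-⊎ (enum-∷ 𝟎 zeros) (enum-∷ (signOf s) same)
                    (startsWith-disjoint (𝟎≢signOf s)))
            (enum-∷ (signOf (not s)) other)
            (λ v → [ startsWith-disjoint (𝟎≢signOf (not s)) v
                   , startsWith-disjoint (signOf≢signOf-not s) v ]))
  where
  Split : Bool → Vec Sign _ → Set
  Split t v = (StartsWith 𝟎 P v ⊎ StartsWith (signOf t) P v) ⊎ StartsWith (signOf (not t)) P v
  merge : ∀ t v → Split t v → P v
  merge t (_ ∷ _) (inj₁ (inj₁ (refl , p))) = p
  merge t (_ ∷ _) (inj₁ (inj₂ (refl , p))) = p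
  merge t (_ ∷ _) (inj₂ (refl , p))        = p
  split : ∀ t v → P v → Split t v
  split t     (𝟎 ∷ w) p = inj₁ (inj₁ (refl , p))
  split true  (⊕ ∷ w) p = inj₁ (inj₂ (refl , p))
  split false (⊕ ∷ w) p = inj₂ (refl , p)
  split true  (⊖ ∷ w) p = inj₂ (refl , p)
  split false (⊖ ∷ w) p = inj₁ (inj₂ (refl , p))

-- Admissible r l s w: w has rank r, and s followed by the nonzero entries of w has at most
-- l sign changes.
Admissible : ∀ {n} → ℕ → ℕ → Bool → Vec Sign n → Set
Admissible r       l       s     []      = r ≡ 0
Admissible r       l       s     (𝟎 ∷ w) = Admissible r l s w
Admissible zero    l       s     (⊕ ∷ w) = ⊥
Admissible (suc r) l       true  (⊕ ∷ w) = Admissible r l true w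
Admissible (suc r) zero    false (⊕ ∷ w) = ⊥
Admissible (suc r) (suc l) false (⊕ ∷ w) = Admissible r l true w
Admissible zero    l       s     (⊖ ∷ w) = ⊥
Admissible (suc r) l       false (⊖ ∷ w) = Admissible r l false w
Admissible (suc r) zero    true  (⊖ ∷ w) = ⊥
Admissible (suc r) (suc l) true  (⊖ ∷ w) = Admissible r l false w

admissible-sound : ∀ {n} r l s (w : Vec Sign n) → Admissible r l s w
                 → rank w ≡ r × changesL (signOf s ∷ nonzeros w) ≤ l
admissible-sound r       l       s     []      refl = refl , z≤n
admissible-sound r       l       s     (𝟎 ∷ w) a    = admissible-sound r l s w a
admissible-sound (suc r) l       true  (⊕ ∷ w) a with admissible-sound r l true w a
... | rk , ch = cong suc rk , ch
admissible-sound (suc r) (suc l) false (⊕ ∷ w) a with admissible-sound r l true w a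
... | rk , ch = cong suc rk , s≤s ch
admissible-sound (suc r) l       false (⊖ ∷ w) a with admissible-sound r l false w a
... | rk , ch = cong suc rk , ch
admissible-sound (suc r) (suc l) true  (⊖ ∷ w) a with admissible-sound r l false w a
... | rk , ch = cong suc rk , s≤s ch

admissible-complete : ∀ {n} l s (w : Vec Sign n) → changesL (signOf s ∷ nonzeros w) ≤ l
                    → Admissible (rank w) l s w
admissible-complete l       s     []      _        = refl
admissible-complete l       s     (𝟎 ∷ w) ch       = admissible-complete l s w ch
admissible-complete l       true  (⊕ ∷ w) ch       = admissible-complete l true w ch
admissible-complete (suc l) false (⊕ ∷ w) (s≤s ch) = admissible-complete l true w ch
admissible-complete l       false (⊖ ∷ w) ch       = admissible-complete l false w ch
admissible-complete (suc l) true  (⊖ ∷ w) (s≤s ch) = admissible-complete l false w ch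

admissible-negV : ∀ {n} r l s (w : Vec Sign n) → Admissible r l s w → Admissible r l (not s) (negV w)
admissible-negV r       l       s     []      a = a
admissible-negV r       l       s     (𝟎 ∷ w) a = admissible-negV r l s w a
admissible-negV (suc r) l       true  (⊕ ∷ w) a = admissible-negV r l true w a
admissible-negV (suc r) (suc l) false (⊕ ∷ w) a = admissible-negV r l true w a
admissible-negV (suc r) l       false (⊖ ∷ w) a = admissible-negV r l false w a
admissible-negV (suc r) (suc l) true  (⊖ ∷ w) a = admissible-negV r l false w a

-- Normalized r l v: v has rank r + 1 (not r), at most l sign changes, and first nonzero entry +.
Normalized : ∀ {n} → ℕ → ℕ → Vec Sign n → Set
Normalized r l []      = ⊥
Normalized r l (𝟎 ∷ w) = Normalized r l w
Normalized r l (⊕ ∷ w) = Admissible r l true w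
Normalized r l (⊖ ∷ w) = ⊥

normalized-sound : ∀ {n} r l (v : Vec Sign n) → Normalized r l v
                 → Any (_≢ 𝟎) v × signChanges v ≤ l × rank v ≡ suc r
normalized-sound r l (𝟎 ∷ w) nv with normalized-sound r l w nv
... | nz , ch , rk = there nz , ch , rk
normalized-sound r l (⊕ ∷ w) nv with admissible-sound r l true w nv
... | rk , ch = here (λ ()) , ch , cong suc rk

normalized-negV-exclusive : ∀ {n} r l (v : Vec Sign n) → Normalized r l v → Normalized r l (negV v) → ⊥
normalized-negV-exclusive r l (𝟎 ∷ w) nv nv′ = normalized-negV-exclusive r l w nv nv′

normalized-complete : ∀ {n} {r} l (v : Vec Sign n) → rank v ≡ suc r → signChanges v ≤ l
                    → Normalized r l v ⊎ Normalized r l (negV v)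
normalized-complete l (𝟎 ∷ w) rk   ch = normalized-complete l w rk ch
normalized-complete l (⊕ ∷ w) refl ch = inj₁ (admissible-complete l true w ch)
normalized-complete l (⊖ ∷ w) refl ch =
  inj₂ (admissible-negV (rank w) l false w (admissible-complete l false w ch))

admissibleCount : ℕ → ℕ → ℕ → ℕ
admissibleCount zero    zero    l       = 1
admissibleCount zero    (suc r) l       = 0
admissibleCount (suc n) zero    l       = admissibleCount n zero l + 0 + 0
admissibleCount (suc n) (suc r) zero    = admissibleCount n (suc r) zero + admissibleCount n r zero + 0
admissibleCount (suc n) (suc r) (suc l) =
  admissibleCount n (suc r) (suc l) + admissibleCount n r (suc l) + admissibleCount n r l

enum-admissible : ∀ n r l s → Enum (Admissible {n} r l s) (admissibleCount n r l)
enum-admissible zero    zero    l       s     = enum-singleton [] refl (λ { [] _ → refl })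
enum-admissible zero    (suc r) l       s     = enum-∅ (λ { [] () })
enum-admissible (suc n) zero    l       true  =
  enum-byHead true (enum-admissible n zero l true) (enum-∅ (λ _ ())) (enum-∅ (λ _ ()))
enum-admissible (suc n) zero    l       false =
  enum-byHead false (enum-admissible n zero l false) (enum-∅ (λ _ ())) (enum-∅ (λ _ ()))
enum-admissible (suc n) (suc r) zero    true  =
  enum-byHead true (enum-admissible n (suc r) zero true) (enum-admissible n r zero true) (enum-∅ (λ _ ()))
enum-admissible (suc n) (suc r) zero    false =
  enum-byHead false (enum-admissible n (suc r) zero false) (enum-admissible n r zero false) (enum-∅ (λ _ ()))
enum-admissible (suc n) (suc r) (suc l) true  =
  enum-byHead true (enum-admissible n (suc r) (suc l) true) (enum-admissible n r (suc l) true)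
                   (enum-admissible n r l false)
enum-admissible (suc n) (suc r) (suc l) false =
  enum-byHead false (enum-admissible n (suc r) (suc l) false) (enum-admissible n r (suc l) false)
                    (enum-admissible n r l true)

normalizedCount : ℕ → ℕ → ℕ → ℕ
normalizedCount zero    r l = 0
normalizedCount (suc n) r l = normalizedCount n r l + admissibleCount n r l + 0

enum-normalized : ∀ n r l → Enum (Normalized {n} r l) (normalizedCount n r l)
enum-normalized zero    r l = enum-∅ (λ { [] () })
enum-normalized (suc n) r l =
  enum-byHead true (enum-normalized n r l) (enum-admissible n r l true) (enum-∅ (λ _ ()))

admissibleCount≡binom*partialSum : ∀ n r l → admissibleCount n r l ≡ binom n r * partialSum r l
admissibleCount≡binom*partialSum zero    zero    l = sym (trans (+-identityʳ _) (partialSum-zero l))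
admissibleCount≡binom*partialSum zero    (suc r) l = refl
admissibleCount≡binom*partialSum (suc n) zero    l
  rewrite admissibleCount≡binom*partialSum n zero l | binom-zero n = trans (+-identityʳ _) (+-identityʳ _)
admissibleCount≡binom*partialSum (suc n) (suc r) zero
  rewrite admissibleCount≡binom*partialSum n (suc r) zero | admissibleCount≡binom*partialSum n r zero
        | binom-zero r = pascal (binom n (suc r)) (binom n r)
  where
  pascal : ∀ a b → a * 1 + b * 1 + 0 ≡ (b + a) * 1
  pascal = solve-∀
admissibleCount≡binom*partialSum (suc n) (suc r) (suc l)
  rewrite admissibleCount≡binom*partialSum n (suc r) (suc l) | admissibleCount≡binom*partialSum n r (suc l)
        | admissibleCount≡binom*partialSum n r l | partialSum-pascal r l =
  pascal (binom n (suc r)) (binom n r) (partialSum r (suc l)) (partialSum r l)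
  where
  pascal : ∀ a b x y → a * (x + y) + b * x + b * y ≡ (b + a) * (x + y)
  pascal = solve-∀

normalizedCount≡binom*partialSum : ∀ n r l → normalizedCount n r l ≡ binom n (suc r) * partialSum r l
normalizedCount≡binom*partialSum zero    r l = refl
normalizedCount≡binom*partialSum (suc n) r l
  rewrite normalizedCount≡binom*partialSum n r l | admissibleCount≡binom*partialSum n r l =
  pascal (binom n (suc r)) (binom n r) (partialSum r l)
  where
  pascal : ∀ a b x → a * x + b * x + 0 ≡ (b + a) * x
  pascal = solve-∀

hasCardMod-RankElem : ∀ {n l r k} → Enum (Normalized {n} r l) k → HasCardMod (RankElem n l (suc r)) _≈P_ k
hasCardMod-RankElem {n} {l} {r} (g , ok , inj , sur) = f , injective , surjective
  where
  f : Fin _ → RankElem n l (suc r)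
  f i = g i , normalized-sound r l (g i) (ok i)
  injective : ∀ i j → f i ≈P f j → i ≡ j
  injective i j (inj₁ e) = inj i j e
  injective i j (inj₂ e) =
    ⊥-elim (normalized-negV-exclusive r l (g j) (ok j) (subst (Normalized r l) e (ok i)))
  surjective : ∀ a → ∃ λ i → f i ≈P a
  surjective (v , _ , ch , rk) with normalized-complete l v rk ch
  ... | inj₁ nv with sur v nv
  ...   | i , e = i , inj₁ e
  surjective (v , _ , ch , rk) | inj₂ nv with sur (negV v) nv
  ...   | i , e = i , inj₂ e

RankElem-card : ∀ n l r → HasCardMod (RankElem n l (suc r)) _≈P_ (W n l (suc r))
RankElem-card n l r =
  subst (HasCardMod (RankElem n l (suc r)) _≈P_)
        (trans (normalizedCount≡binom*partialSum n r l) (sym (W≡binom*partialSum n l r)))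
        (hasCardMod-RankElem (enum-normalized n r l))

theorem5p2 : (n l : ℕ) → l < n →
    ((r : ℕ) → 1 ≤ r → r ≤ n → HasCardMod (RankElem n l r) _≈P_ (W n l r))
    × ((i : ℕ) → 2 ≤ i → i ≤ n ∸ 1 → W n l (i ∸ 1) * W n l (i + 1) ≤ W n l i * W n l i)
theorem5p2 n l _ =
    (λ { (suc r) _ _ → RankElem-card n l r })
  , (λ i 2≤i _ → W-logConcave n l i 2≤i)
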